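{- Let $N$ and $N'$ be DC $X$-networks with $V(N')\subseteq V(N)$. Assume (i) whenever $u<v$ in $N'$, then $u<v$ in $N$; and (ii) whenever $u,v\in V(N')$ and $u<v$ in $N$, then $u<v$ in $N'$. Then there exist a cluster-preserving simplification $N''=(V'',E'',r,X)$ of $N$ with no redundant arcs and finitely many pairs $(a_i,b_i)$, $i=1,\dots,k$, with $a_i,b_i\in V''$, $a_i<b_i$ in $N''$ and $(a_i,b_i)\notin E''$, such that $N'$ is obtained from $N''$ by adjoining the arcs $(a_i,b_i)$ to $E''$.
   Context: An $X$-network $N=(V,E,r,X)$ is a finite directed graph (no loops, no multiple arcs) that is acyclic, has a root $r$ (every vertex reachable from $r$ by a directed path), and whose leaves (out-degree $0$) are identified bijectively with $X$. The cluster of $v$ is $cl(v;N)=\{x\in X:\text{there is a directed path (possibly of length }0\text{) from } v\text{ to } x\}$; $N$ is distinct-cluster (DC) if distinct vertices have distinct clusters. Vertices of DC networks are identified with their clusters, so $V(N')\subseteq V(N)$ means every cluster of a vertex of $N'$ is the cluster of a vertex of $N$. $u<v$ means there is a directed path from $u$ to $v$ and $u\neq v$. An arc $(a,b)$ is redundant if there is a directed path from $a$ to $b$ of length greater than $1$. For a vertex $v\neq r$, $v\notin X$ with parents $q_1,\dots,q_k$ and children $c_1,\dots,c_m$, $D(v)N$ deletes $v$ and its incident arcs and adds arcs $(q_i,c_j)$ for all $i,j$ (no duplicates); for a redundant arc $(a,b)$, $D(a,b)N$ deletes that arc. A DC $X$-network $N'$ is a cluster-preserving simplification (CPS) of $N$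 if there is a sequence $N=N_0,\dots,N_k=N'$ ($k\ge0$) of DC $X$-networks with each $N_{i+1}=D(v)N_i$ for a non-root non-leaf vertex $v$ of $N_i$ or $N_{i+1}=D(a,b)N_i$ for a redundant arc $(a,b)$ of $N_i$. -}

module Defs where

open import Data.Nat using (ℕ)
open import Data.Bool using (Bool; T)
open import Data.Fin using (Fin)
open import Data.Fin.Subset using (Subset; _∈_; ⁅_⁆)
open import Data.Product using (Σ; ∃; _×_; _,_)
open import Data.Sum using (_⊎_)
open import Data.List using (List)
open import Data.List.Relation.Unary.All using (All)
import Data.List.Membership.Propositional as LMem
open import Relation.Nullary using (¬_)
open import Relation.Binary.PropositionalEquality using (_≡_; _≢_)
open import Relation.Binary.Construct.Closure.ReflexiveTransitive using (Star)
open import Relation.Binary.Construct.Closure.Transitive using (TransClosure)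
open import Function.Bundles using (_⇔_)

-- X = Fin n.  Following the paper's convention, vertices of a DC network are
-- identified with their clusters, so a (DC) X-network is represented by a
-- set of clusters (a Bool-valued predicate on Subset n, automatically finite),
-- an arc relation on them and a root.
record Net (n : ℕ) : Set where
  field
    V    : Subset n → Bool
    E    : Subset n → Subset n → Bool
    root : Subset n
open Net public

module _ {n : ℕ} (N : Net n) where

  InV : Subset n → Set
  InV u = T (V N u)

  Arc : Subset n → Subset n → Set
  Arc a b = T (E N a b)

  Path : Subset n → Subset n → Set
  Path = Star Arc

  Lt : Subset n → Subset n → Set
  Lt u v = Path u v × u ≢ v

  IsLeaf : Subset n → Set
  IsLeaf v = ∀ w → ¬ Arc v w

  Redundant : Subset n → Subset n → Set
  Redundant a b = Arc a b × ∃ λ c → Arc a c × TransClosure Arc c b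

  NoRedundantArcs : Set
  NoRedundantArcs = ∀ a b → ¬ Redundant a b

  record IsDCNet : Set where
    field
      arcs-in-V   : ∀ a b → Arc a b → InV a × InV b
      no-loops    : ∀ v → ¬ Arc v v
      acyclic     : ∀ v → ¬ TransClosure Arc v v
      root-in-V   : InV (root N)
      rooted      : ∀ v → InV v → Path (root N) v
      leaves-X    : ∀ x → InV ⁅ x ⁆ × IsLeaf ⁅ x ⁆
      leaves-only : ∀ v → InV v → IsLeaf v → ∃ λ x → v ≡ ⁅ x ⁆
      -- each vertex is (named by) its cluster: cl(v) = v
      cluster     : ∀ v → InV v → ∀ x → (x ∈ v ⇔ Path v ⁅ x ⁆)

record DelVertex {n : ℕ} (v : Subset n) (N M : Net n) : Set where
  field
    v-in-V    : InV N v
    v-nonroot : v ≢ root N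
    v-nonleaf : ¬ IsLeaf N v
    same-root : root M ≡ root N
    verts     : ∀ u → (InV M u ⇔ (InV N u × u ≢ v))
    arcs      : ∀ a b → (Arc M a b ⇔
                  ((Arc N a b × a ≢ v × b ≢ v) ⊎ (Arc N a v × Arc N v b)))

record DelArc {n : ℕ} (a b : Subset n) (N M : Net n) : Set where
  field
    redundant : Redundant N a b
    same-root : root M ≡ root N
    verts     : ∀ u → (InV M u ⇔ InV N u)
    arcs      : ∀ c d → (Arc M c d ⇔ (Arc N c d × (c , d) ≢ (a , b)))

Step : {n : ℕ} → Net n → Net n → Set
Step N M = IsDCNet M × ((∃ λ v → DelVertex v N M) ⊎ (∃ λ a → ∃ λ b → DelArc a b N M))

-- M is a cluster-preserving simplification of N (N assumed DC separately)
CPS : {n : ℕ} → Net n → Net n → Set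
CPS = Star Step

AdjoinArcs : {n : ℕ} → Net n → List (Subset n × Subset n) → Net n → Set
AdjoinArcs {n} N'' ps N' =
  root N' ≡ root N''
  × (∀ u → (InV N' u ⇔ InV N'' u))
  × (∀ a b → (Arc N' a b ⇔ (Arc N'' a b ⊎ (a , b) LMem.∈ ps)))

module Submission where

-- Delete from N, one at a time, every vertex outside N′ (none of them is the root ⊤ or a
-- leaf, which the two DC networks share), then every redundant arc. Each deletion keeps the
-- network DC and preserves reachability between surviving vertices, so the result N″ has the
-- vertices of N′ and, by (i) and (ii), the same reachability as N′. An arc a → b of the
-- irredundant N″ is then an arc of N′: the path of N′ from a to b cannot leave a towards any
-- c ≠ b, since a → c ⇝ b would make (a, b) redundant in N″. So N′ is N″ together with the
-- arcs of N′ missing from N″.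

open import Defs
open import Data.Nat using (ℕ)
open import Data.Bool using (T; _∧_; _∨_) renaming (_≟_ to _≟ᵇ_)
open import Data.Bool.Properties using (T-∧; T-∨)
open import Data.Fin.Subset using (Subset; inside; outside; ⁅_⁆; _⊆_; _⊂_; ⊤)
open import Data.Fin.Subset.Properties
  using (⊆-antisym; ∈⊤; drop-∷-⊆; s⊂s; out⊂in; anySubset?)
open import Data.Fin.Subset.Induction using (⊂-wellFounded)
open import Data.Vec using ([]; _∷_; here)
open import Data.Vec.Properties using (≡-dec)
open import Data.Product using (Σ; ∃; _×_; _,_; proj₁; proj₂; uncurry)
import Data.Product.Properties as Product
open import Data.Product.Function.NonDependent.Propositional using (_×-⇔_)
open import Data.Sum using (_⊎_; inj₁; inj₂)
open import Data.Sum.Function.Propositional using (_⊎-⇔_)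
open import Data.List using (List; []; _∷_; cartesianProduct; cartesianProductWith; filter)
open import Data.List.Relation.Unary.All using (All; []; _∷_; tabulate; lookup)
open import Data.List.Relation.Unary.Any using (here; there)
open import Data.List.Membership.Propositional using () renaming (_∈_ to _∈ₗ_)
open import Data.List.Membership.Propositional.Properties
  using (∈-cartesianProductWith⁺; ∈-cartesianProduct⁺; ∈-filter⁺; ∈-filter⁻)
open import Function using (_∘_; id; case_of_)
open import Function.Bundles using (_⇔_; mk⇔; Equivalence)
open import Function.Properties.Equivalence
  using () renaming (refl to ⇔-refl; sym to ⇔-sym; trans to ⇔-trans)
open import Induction.WellFounded using (WellFounded; Acc; acc; module Subrelation)
open import Relation.Nullary using (¬_; Dec; yes; no; contradiction; ¬?)
open import Relation.Nullary.Decidable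
  using (T?; _×-dec_; map′; isNo; toWitnessFalse; fromWitnessFalse; decidable-stable)
open import Relation.Binary.Definitions using (DecidableEquality)
open import Relation.Binary.PropositionalEquality using (_≡_; _≢_; refl; sym; trans; cong; subst)
open import Relation.Binary.Construct.Closure.ReflexiveTransitive
  using (Star; ε; _◅_; _◅◅_; _⋆; return)
open import Relation.Binary.Construct.Closure.Transitive using (TransClosure; [_]; _∷_; _++_)

open Equivalence using (to; from)

private
  variable
    n : ℕ

module _ {A : Set} {R : A → A → Set} where

  plus⇒star : ∀ {a b} → TransClosure R a b → Star R a b
  plus⇒star [ r ] = r ◅ ε
  plus⇒star (r ∷ rs) = r ◅ plus⇒star rs

  _◅⁺_ : ∀ {a b c} → R a b → Star R b c → TransClosure R a c
  r ◅⁺ ε = [ r ]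
  r ◅⁺ (s ◅ ss) = r ∷ (s ◅⁺ ss)

  _◅◅⁺_ : ∀ {a b c} → Star R a b → TransClosure R b c → TransClosure R a c
  ε ◅◅⁺ rs = rs
  (r ◅ ss) ◅◅⁺ rs = r ∷ (ss ◅◅⁺ rs)

  star⇒plus : ∀ {a b} → Star R a b → a ≢ b → TransClosure R a b
  star⇒plus ε a≢a = contradiction refl a≢a
  star⇒plus (r ◅ ss) _ = r ◅⁺ ss

  plus⇔◅star : ∀ {a c} → TransClosure R a c ⇔ ∃ λ b → R a b × Star R b c
  plus⇔◅star = mk⇔ uncons (λ (_ , r , ss) → r ◅⁺ ss)
    where
    uncons : ∀ {a c} → TransClosure R a c → ∃ λ b → R a b × Star R b c
    uncons [ r ] = _ , r , ε
    uncons (r ∷ rs) = _ , r , plus⇒star rs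

concatMap⁺ : {A : Set} {R S : A → A → Set} → (∀ {a b} → R a b → TransClosure S a b)
           → ∀ {a b} → TransClosure R a b → TransClosure S a b
concatMap⁺ f [ r ] = f r
concatMap⁺ f (r ∷ rs) = f r ++ concatMap⁺ f rs

_≟_ : DecidableEquality (Subset n)
_≟_ = ≡-dec _≟ᵇ_

_≟ₚ_ : DecidableEquality (Subset n × Subset n)
_≟ₚ_ = Product.≡-dec _≟_ _≟_

p⊆q∧p≢q⇒p⊂q : {p q : Subset n} → p ⊆ q → p ≢ q → p ⊂ q
p⊆q∧p≢q⇒p⊂q {p = []} {[]} _ p≢q = contradiction refl p≢q
p⊆q∧p≢q⇒p⊂q {p = outside ∷ p} {outside ∷ q} p⊆q p≢q =
  s⊂s (p⊆q∧p≢q⇒p⊂q (drop-∷-⊆ p⊆q) (p≢q ∘ cong (outside ∷_)))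
p⊆q∧p≢q⇒p⊂q {p = outside ∷ p} {inside ∷ q} p⊆q _ = out⊂in (drop-∷-⊆ p⊆q)
p⊆q∧p≢q⇒p⊂q {p = inside ∷ p} {outside ∷ q} p⊆q _ = case p⊆q here of λ ()
p⊆q∧p≢q⇒p⊂q {p = inside ∷ p} {inside ∷ q} p⊆q p≢q =
  s⊂s (p⊆q∧p≢q⇒p⊂q (drop-∷-⊆ p⊆q) (p≢q ∘ cong (inside ∷_)))

subsets : ∀ n → List (Subset n)
subsets ℕ.zero = [] ∷ []
subsets (ℕ.suc n) = cartesianProductWith _∷_ (inside ∷ outside ∷ []) (subsets n)

∈-subsets : (p : Subset n) → p ∈ₗ subsets n
∈-subsets [] = here refl
∈-subsets (inside ∷ p) =
  ∈-cartesianProductWith⁺ _∷_ {xs = inside ∷ outside ∷ []} (here refl) (∈-subsets p)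
∈-subsets (outside ∷ p) =
  ∈-cartesianProductWith⁺ _∷_ {xs = inside ∷ outside ∷ []} (there (here refl)) (∈-subsets p)

subsetPairs : ∀ n → List (Subset n × Subset n)
subsetPairs n = cartesianProduct (subsets n) (subsets n)

∈-subsetPairs : (p q : Subset n) → (p , q) ∈ₗ subsetPairs n
∈-subsetPairs p q = ∈-cartesianProduct⁺ (∈-subsets p) (∈-subsets q)

redundant-via : ∀ {N : Net n} {a b c} → Arc N a b
              → TransClosure (Arc N) a c → TransClosure (Arc N) c b → Redundant N a b
redundant-via ab a⁺c c⁺b =
  let (e , ae , e*c) = to plus⇔◅star a⁺c in ab , e , ae , e*c ◅◅⁺ c⁺b

_⊆ⱽ_ : Net n → Net n → Set
M ⊆ⱽ N = ∀ {u} → InV M u → InV N u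

_⊆ᴬ_ : Net n → Net n → Set
M ⊆ᴬ N = ∀ {a b} → Arc M a b → Arc N a b

redundant-mono : {M' M : Net n} → M' ⊆ᴬ M → ∀ {a b} → Redundant M' a b → Redundant M a b
redundant-mono f (ab , c , ac , c⁺b) = f ab , c , f ac , concatMap⁺ ([_] ∘ f) c⁺b

Child : Net n → Subset n → Subset n → Set
Child N w u = Arc N u w

module DCNet {N : Net n} (dc : IsDCNet N) where
  open IsDCNet dc

  path⇒⊇ : ∀ {a b} → InV N a → InV N b → Path N a b → b ⊆ a
  path⇒⊇ a∈ b∈ a*b {x} x∈b = from (cluster _ a∈ x) (a*b ◅◅ to (cluster _ b∈ x) x∈b)

  arc⇒⊂ : ∀ {a b} → Arc N a b → b ⊂ a
  arc⇒⊂ {a} ab =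
    let (a∈ , b∈) = arcs-in-V _ _ ab
    in p⊆q∧p≢q⇒p⊂q (path⇒⊇ a∈ b∈ (ab ◅ ε)) λ { refl → no-loops a ab }

  child-wellFounded : WellFounded (Child N)
  child-wellFounded = Subrelation.wellFounded arc⇒⊂ ⊂-wellFounded

  root≡⊤ : root N ≡ ⊤
  root≡⊤ = ⊆-antisym (λ _ → ∈⊤) λ {x} _ →
    from (cluster _ root-in-V x) (rooted _ (proj₁ (leaves-X x)))

  path? : ∀ u w → Dec (Path N u w)
  path? u w = search (child-wellFounded u)
    where
    search : ∀ {u} → Acc (Child N) u → Dec (Path N u w)
    search {u} (acc rec) with u ≟ w
    ... | yes refl = yes ε
    ... | no u≢w = map′ (λ (_ , uc , c*w) → uc ◅ c*w)
                        (λ u*w → to plus⇔◅star (star⇒plus u*w u≢w))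
                        (anySubset? via)
      where
      via : ∀ c → Dec (Arc N u c × Path N c w)
      via c with T? (E N u c)
      ... | no ¬uc = no (¬uc ∘ proj₁)
      ... | yes uc = map′ (uc ,_) proj₂ (search (rec uc))

  plus? : ∀ u w → Dec (TransClosure (Arc N) u w)
  plus? u w = map′ (from plus⇔◅star) (to plus⇔◅star)
    (anySubset? λ c → T? (E N u c) ×-dec path? c w)

  redundant? : ∀ a b → Dec (Redundant N a b)
  redundant? a b = T? (E N a b) ×-dec anySubset? λ c → T? (E N a c) ×-dec plus? c b

roots-agree : {M K : Net n} → IsDCNet M → IsDCNet K → root M ≡ root K
roots-agree dcM dcK = trans (DCNet.root≡⊤ dcM) (sym (DCNet.root≡⊤ dcK))

record Restricts (M N : Net n) : Set where
  field
    same-root    : root M ≡ root N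
    root∈        : InV M (root N)
    leaves∈      : ∀ x → InV M ⁅ x ⁆
    verts⊆       : M ⊆ⱽ N
    arcs-in-V    : ∀ a b → Arc M a b → InV M a × InV M b
    arc⁺         : ∀ {a b} → Arc M a b → TransClosure (Arc N) a b
    path⁻        : ∀ {u w} → InV M u → InV M w → Path N u w → Path M u w
    leaf-reflect : ∀ {u} → InV M u → IsLeaf M u → IsLeaf N u

  path⁺ : ∀ {u w} → Path M u w → Path N u w
  path⁺ = (plus⇒star ∘ arc⁺) ⋆

  path⇔ : ∀ {u w} → InV M u → InV M w → Path M u w ⇔ Path N u w
  path⇔ u∈ w∈ = mk⇔ path⁺ (path⁻ u∈ w∈)

restricts-refl : {N : Net n} → IsDCNet N → Restricts N N
restricts-refl dc = record
  { same-root = refl ; root∈ = root-in-V ; leaves∈ = proj₁ ∘ leaves-X ; verts⊆ = id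
  ; arcs-in-V = arcs-in-V ; arc⁺ = [_] ; path⁻ = λ _ _ → id ; leaf-reflect = λ _ → id }
  where open IsDCNet dc

restricts-trans : {K M N : Net n} → Restricts K M → Restricts M N → Restricts K N
restricts-trans {K = K} K≤M M≤N = record
  { same-root = trans K≤M.same-root M≤N.same-root
  ; root∈ = subst (InV K) M≤N.same-root K≤M.root∈
  ; leaves∈ = K≤M.leaves∈
  ; verts⊆ = M≤N.verts⊆ ∘ K≤M.verts⊆
  ; arcs-in-V = K≤M.arcs-in-V
  ; arc⁺ = concatMap⁺ M≤N.arc⁺ ∘ K≤M.arc⁺
  ; path⁻ = λ u∈ w∈ →
      K≤M.path⁻ u∈ w∈ ∘ M≤N.path⁻ (K≤M.verts⊆ u∈) (K≤M.verts⊆ w∈)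
  ; leaf-reflect = λ u∈ → M≤N.leaf-reflect (K≤M.verts⊆ u∈) ∘ K≤M.leaf-reflect u∈
  }
  where module K≤M = Restricts K≤M ; module M≤N = Restricts M≤N

restricts-isDC : {M N : Net n} → IsDCNet N → Restricts M N → IsDCNet M
restricts-isDC {M = M} {N} dc M≤N = record
  { arcs-in-V = arcs-in-V
  ; no-loops = λ v vv → N.acyclic v (arc⁺ vv)
  ; acyclic = λ v v⁺v → N.acyclic v (concatMap⁺ arc⁺ v⁺v)
  ; root-in-V = subst (InV M) (sym same-root) root∈
  ; rooted = λ v v∈ → subst (λ r → Path M r v) (sym same-root)
                       (path⁻ root∈ v∈ (N.rooted v (verts⊆ v∈)))
  ; leaves-X = λ x → leaves∈ x , λ w xw →
      proj₂ (N.leaves-X x) _ (proj₁ (proj₂ (to plus⇔◅star (arc⁺ xw))))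
  ; leaves-only = λ v v∈ leaf → N.leaves-only v (verts⊆ v∈) (leaf-reflect v∈ leaf)
  ; cluster = λ v v∈ x → ⇔-trans (N.cluster v (verts⊆ v∈) x) (⇔-sym (path⇔ v∈ (leaves∈ x)))
  }
  where open Restricts M≤N ; module N = IsDCNet dc

module _ {v : Subset n} {N M : Net n} (dc : IsDCNet N) (d : DelVertex v N M) where
  open IsDCNet dc
  open DelVertex d

  private
    survives : ∀ {u} → InV N u → u ≢ v → InV M u
    survives u∈ u≢v = from (verts _) (u∈ , u≢v)

    kept : ∀ {a b} → Arc N a b → a ≢ v → b ≢ v → Arc M a b
    kept ab a≢v b≢v = from (arcs _ _) (inj₁ (ab , a≢v , b≢v))

    bypass : ∀ {a b} → Arc N a v → Arc N v b → Arc M a b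
    bypass av vb = from (arcs _ _) (inj₂ (av , vb))

    tail≢v : ∀ {b} → Arc N v b → b ≢ v
    tail≢v vb refl = no-loops _ vb

    head≢v : ∀ {a} → Arc N a v → a ≢ v
    head≢v av refl = no-loops _ av

    ends : ∀ a b → Arc M a b → InV M a × InV M b
    ends a b ab with to (arcs a b) ab
    ... | inj₁ (ab , a≢v , b≢v) =
      let (a∈ , b∈) = arcs-in-V a b ab in survives a∈ a≢v , survives b∈ b≢v
    ... | inj₂ (av , vb) = survives (proj₁ (arcs-in-V a v av)) (head≢v av)
                         , survives (proj₂ (arcs-in-V v b vb)) (tail≢v vb)

    arc⁺ : ∀ {a b} → Arc M a b → TransClosure (Arc N) a b
    arc⁺ ab with to (arcs _ _) ab
    ... | inj₁ (ab , _) = [ ab ]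
    ... | inj₂ (av , vb) = av ∷ [ vb ]

    reroute : ∀ {a b} → a ≢ v → b ≢ v → Path N a b → Path M a b
    reroute _ _ ε = ε
    reroute a≢v b≢v (_◅_ {j = c} ac c*b) with c ≟ v
    ... | no c≢v = kept ac a≢v c≢v ◅ reroute c≢v b≢v c*b
    ... | yes refl with c*b
    ...   | ε = contradiction refl b≢v
    ...   | ve ◅ e*b = bypass ac ve ◅ reroute (tail≢v ve) b≢v e*b

    leaf-reflect : ∀ {u} → InV M u → IsLeaf M u → IsLeaf N u
    leaf-reflect {u} u∈ leaf w uw with w ≟ v
    ... | no w≢v = leaf w (kept uw (proj₂ (to (verts u) u∈)) w≢v)
    ... | yes refl = v-nonleaf λ e ve → leaf e (bypass uw ve)

  delVertex⇒restricts : Restricts M N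
  delVertex⇒restricts = record
    { same-root = same-root
    ; root∈ = survives root-in-V (v-nonroot ∘ sym)
    ; leaves∈ = λ x → survives (proj₁ (leaves-X x)) λ { refl → v-nonleaf (proj₂ (leaves-X x)) }
    ; verts⊆ = proj₁ ∘ to (verts _)
    ; arcs-in-V = ends
    ; arc⁺ = arc⁺
    ; path⁻ = λ u∈ w∈ → reroute (proj₂ (to (verts _) u∈)) (proj₂ (to (verts _) w∈))
    ; leaf-reflect = leaf-reflect
    }

module _ {a b : Subset n} {N M : Net n} (dc : IsDCNet N) (d : DelArc a b N M) where
  open IsDCNet dc
  open DelArc d
  open DCNet dc using (child-wellFounded)

  private
    kept : ∀ {c e} → Arc N c e → (c , e) ≢ (a , b) → Arc M c e
    kept ce ce≢ab = from (arcs _ _) (ce , ce≢ab)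

    arc⁻ : ∀ {c e} → Arc M c e → Arc N c e
    arc⁻ ce = proj₁ (to (arcs _ _) ce)

    detour : Redundant N a b → ∃ λ c → Arc M a c × TransClosure (Arc N) c b
    detour (_ , c , ac , c⁺b) = c , kept ac (λ { refl → acyclic _ c⁺b }) , c⁺b

    -- The deleted arc (a, b) is replaced by its detour a → c ⇝ b; the recursion on the
    -- source vertex is well founded because clusters strictly shrink along arcs.
    reroute : ∀ {c e} → Acc (Child N) c → Path N c e → Path M c e
    reroute _ ε = ε
    reroute {c} (acc rec) (_◅_ {j = e} ce e*f) with (c , e) ≟ₚ (a , b)
    ... | no ce≢ab = kept ce ce≢ab ◅ reroute (rec ce) e*f
    ... | yes refl = let (w , aw , w⁺b) = detour redundant
                     in (aw ◅ reroute (rec (arc⁻ aw)) (plus⇒star w⁺b)) ◅◅ reroute (rec ce) e*f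

    path⁻ : ∀ {c e} → Path N c e → Path M c e
    path⁻ = reroute (child-wellFounded _)

    leaf-reflect : ∀ {u} → InV M u → IsLeaf M u → IsLeaf N u
    leaf-reflect {u} _ leaf w uw with path⁻ (uw ◅ ε)
    ... | ε = no-loops u uw
    ... | uc ◅ _ = leaf _ uc

  delArc⇒restricts : Restricts M N
  delArc⇒restricts = record
    { same-root = same-root
    ; root∈ = from (verts _) root-in-V
    ; leaves∈ = from (verts _) ∘ proj₁ ∘ leaves-X
    ; verts⊆ = to (verts _)
    ; arcs-in-V = λ c e ce →
        let (c∈ , e∈) = arcs-in-V c e (arc⁻ ce) in from (verts c) c∈ , from (verts e) e∈
    ; arc⁺ = [_] ∘ arc⁻
    ; path⁻ = λ _ _ → path⁻
    ; leaf-reflect = leaf-reflect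
    }

step⇒restricts : {N M : Net n} → IsDCNet N → Step N M → Restricts M N
step⇒restricts dc (_ , inj₁ (_ , d)) = delVertex⇒restricts dc d
step⇒restricts dc (_ , inj₂ (_ , _ , d)) = delArc⇒restricts dc d

cps⇒restricts : {N M : Net n} → IsDCNet N → CPS N M → Restricts M N
cps⇒restricts dc ε = restricts-refl dc
cps⇒restricts dc (s ◅ ss) = restricts-trans (cps⇒restricts (proj₁ s) ss) (step⇒restricts dc s)

cps⇒isDC : {N M : Net n} → IsDCNet N → CPS N M → IsDCNet M
cps⇒isDC dc = restricts-isDC dc ∘ cps⇒restricts dc

deleteVertex : Subset n → Net n → Net n
deleteVertex v N = record
  { V = λ u → V N u ∧ isNo (u ≟ v)
  ; E = λ a b → (E N a b ∧ isNo (a ≟ v) ∧ isNo (b ≟ v)) ∨ (E N a v ∧ E N v b)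
  ; root = root N
  }

deleteArc : Subset n → Subset n → Net n → Net n
deleteArc a b N = record
  { V = V N
  ; E = λ c e → E N c e ∧ isNo ((c , e) ≟ₚ (a , b))
  ; root = root N
  }

T-isNo : ∀ {P : Set} (p? : Dec P) → T (isNo p?) ⇔ (¬ P)
T-isNo _ = mk⇔ toWitnessFalse fromWitnessFalse

deleteVertex-isDelVertex : {v : Subset n} {N : Net n} → InV N v → v ≢ root N → ¬ IsLeaf N v
                         → DelVertex v N (deleteVertex v N)
deleteVertex-isDelVertex {v = v} v∈ v≢r v-nonleaf = record
  { v-in-V = v∈ ; v-nonroot = v≢r ; v-nonleaf = v-nonleaf ; same-root = refl
  ; verts = λ u → ⇔-trans T-∧ (⇔-refl ×-⇔ T-isNo (u ≟ v))
  ; arcs = λ a b → ⇔-trans T-∨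
      (⇔-trans T-∧ (⇔-refl ×-⇔ ⇔-trans T-∧ (T-isNo (a ≟ v) ×-⇔ T-isNo (b ≟ v))) ⊎-⇔ T-∧)
  }

deleteArc-isDelArc : {a b : Subset n} {N : Net n} → Redundant N a b → DelArc a b N (deleteArc a b N)
deleteArc-isDelArc {a = a} {b} r = record
  { redundant = r ; same-root = refl
  ; verts = λ _ → ⇔-refl
  ; arcs = λ c e → ⇔-trans T-∧ (⇔-refl ×-⇔ T-isNo ((c , e) ≟ₚ (a , b)))
  }

delVertex-step : {v : Subset n} {N M : Net n} → IsDCNet N → DelVertex v N M → Step N M
delVertex-step dc d = restricts-isDC dc (delVertex⇒restricts dc d) , inj₁ (_ , d)

delArc-step : {a b : Subset n} {N M : Net n} → IsDCNet N → DelArc a b N M → Step N M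
delArc-step dc d = restricts-isDC dc (delArc⇒restricts dc d) , inj₂ (_ , _ , d)

module Sweep {S A : Set} (Good : S → Set) (_⊑_ : S → S → Set)
  (⊑-refl : ∀ {s} → s ⊑ s) (⊑-trans : ∀ {s t u} → s ⊑ t → t ⊑ u → s ⊑ u)
  (Bad : S → A → Set) (Bad-mono : ∀ {s t x} → s ⊑ t → Bad s x → Bad t x)
  (bad? : ∀ {s} → Good s → ∀ x → Dec (Bad s x))
  (repair : ∀ {s x} → Good s → Bad s x → ∃ λ t → Good t × t ⊑ s × ¬ Bad t x)
  where

  -- Bad-mono guarantees that repairing a later defect never reintroduces an earlier one.
  settle : ∀ {s} → Good s → ∀ x → ∃ λ t → Good t × t ⊑ s × ¬ Bad t x
  settle g x with bad? g x
  ... | yes bad = repair g bad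
  ... | no ok = _ , g , ⊑-refl , ok

  sweep : ∀ {s} → Good s → (xs : List A)
        → ∃ λ t → Good t × t ⊑ s × All (λ x → ¬ Bad t x) xs
  sweep g [] = _ , g , ⊑-refl , []
  sweep g (x ∷ xs) =
    let (u , gu , u⊑s , ok) = settle g x
        (t , gt , t⊑u , oks) = sweep gu xs
    in t , gt , ⊑-trans t⊑u u⊑s , (ok ∘ Bad-mono t⊑u) ∷ oks

module _ {N N' : Net n} (dcN : IsDCNet N) (dcN' : IsDCNet N') where

  delete-vertices-outside : (∀ u → InV N' u → InV N u)
                          → ∃ λ M → CPS N M × (∀ u → InV N' u ⇔ InV M u)
  delete-vertices-outside N'⊆N =
    let (M , (cps , N'⊆M) , _ , ok) = sweep (ε , N'⊆N _) (subsets _)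
    in M , cps , λ u → mk⇔ N'⊆M λ u∈M →
         decidable-stable (T? (V N' u)) λ u∉N' → lookup ok (∈-subsets u) (u∈M , u∉N')
    where
    Good : Net n → Set
    Good M = CPS N M × N' ⊆ⱽ M

    repair : ∀ {M u} → Good M → InV M u × ¬ InV N' u
           → ∃ λ M' → Good M' × M' ⊆ⱽ M × ¬ (InV M' u × ¬ InV N' u)
    repair {M} {u} (cps , N'⊆M) (u∈M , u∉N') =
      deleteVertex u M
      , (cps ◅◅ return (delVertex-step dcM d) , λ w∈N' →
           from (verts _) (N'⊆M w∈N' , λ { refl → u∉N' w∈N' }))
      , proj₁ ∘ to (verts _)
      , λ (u∈ , _) → proj₂ (to (verts u) u∈) refl
      where
      dcM : IsDCNet M
      dcM = cps⇒isDC dcN cps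
      u≢root : u ≢ root M
      u≢root u≡r =
        u∉N' (subst (InV N') (sym (trans u≡r (roots-agree dcM dcN'))) (IsDCNet.root-in-V dcN'))
      u-nonleaf : ¬ IsLeaf M u
      u-nonleaf leaf with IsDCNet.leaves-only dcM u u∈M leaf
      ... | x , refl = u∉N' (proj₁ (IsDCNet.leaves-X dcN' x))
      d : DelVertex u M (deleteVertex u M)
      d = deleteVertex-isDelVertex u∈M u≢root u-nonleaf
      open DelVertex d

    open Sweep Good _⊆ⱽ_ id (λ f g → g ∘ f)
      (λ M u → InV M u × ¬ InV N' u) (λ f (u∈ , u∉) → f u∈ , u∉)
      (λ {M} _ u → T? (V M u) ×-dec ¬? (T? (V N' u))) repair

module _ {N : Net n} (dcN : IsDCNet N) where

  delete-redundant-arcs : ∀ {M} → CPS N M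
                        → ∃ λ N'' → CPS N N'' × (∀ u → InV M u ⇔ InV N'' u)
                                   × NoRedundantArcs N''
  delete-redundant-arcs {M} cps =
    let (N'' , (cps'' , M⇔N'') , _ , ok) = sweep (cps , λ _ → ⇔-refl) (subsetPairs _)
    in N'' , cps'' , M⇔N'' , λ a b → lookup ok (∈-subsetPairs a b)
    where
    Good : Net n → Set
    Good K = CPS N K × (∀ u → InV M u ⇔ InV K u)

    repair : ∀ {K p} → Good K → uncurry (Redundant K) p
           → ∃ λ K' → Good K' × K' ⊆ᴬ K × ¬ uncurry (Redundant K') p
    repair {K} {a , b} (cps , M⇔K) r =
      deleteArc a b K
      , (cps ◅◅ return (delArc-step dcK d) , λ u → ⇔-trans (M⇔K u) (⇔-sym (verts u)))
      , proj₁ ∘ to (arcs _ _)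
      , λ (ab , _) → proj₂ (to (arcs a b) ab) refl
      where
      dcK : IsDCNet K
      dcK = cps⇒isDC dcN cps
      d : DelArc a b K (deleteArc a b K)
      d = deleteArc-isDelArc r
      open DelArc d

    open Sweep Good _⊆ᴬ_ id (λ f g → g ∘ f)
      (uncurry ∘ Redundant) (λ {K'} {K} K'⊆K → redundant-mono {M' = K'} {M = K} K'⊆K)
      (λ (cps , _) (a , b) → DCNet.redundant? (cps⇒isDC dcN cps) a b) repair

Shortcut : Net n → Subset n × Subset n → Set
Shortcut M p =
  InV M (proj₁ p) × InV M (proj₂ p) × Lt M (proj₁ p) (proj₂ p) × ¬ Arc M (proj₁ p) (proj₂ p)

module _ {M K : Net n} (dcM : IsDCNet M) (dcK : IsDCNet K) (irredundant : NoRedundantArcs M)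
  (same-verts : ∀ u → InV K u ⇔ InV M u)
  (same-paths : ∀ {u w} → InV M u → InV M w → Path M u w ⇔ Path K u w) where

  private
    module M = IsDCNet dcM
    module K = IsDCNet dcK

    ends : ∀ {a b} → Arc K a b → InV M a × InV M b
    ends ab = let (a∈ , b∈) = K.arcs-in-V _ _ ab in to (same-verts _) a∈ , to (same-verts _) b∈

    arc⇒lt : ∀ {a b} → Arc K a b → Lt M a b
    arc⇒lt ab =
      let (a∈ , b∈) = ends ab in from (same-paths a∈ b∈) (ab ◅ ε) , λ { refl → K.no-loops _ ab }

  irredundant⇒arcs⊆ : M ⊆ᴬ K
  irredundant⇒arcs⊆ {a} {b} ab
    with to plus⇔◅star (star⇒plus (to (uncurry same-paths (M.arcs-in-V a b ab)) (ab ◅ ε))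
                                  λ { refl → M.no-loops a ab })
  ... | c , ac , c*b with c ≟ b
  ...   | yes refl = ac
  ...   | no c≢b =
    contradiction (redundant-via {N = M} ab (uncurry star⇒plus (arc⇒lt ac)) c⁺b) (irredundant a b)
    where
    c⁺b : TransClosure (Arc M) c b
    c⁺b = star⇒plus (from (same-paths (proj₂ (ends ac)) (proj₂ (M.arcs-in-V a b ab))) c*b) c≢b

  adjoin-shortcuts : Σ (List (Subset n × Subset n)) λ ps → All (Shortcut M) ps × AdjoinArcs M ps K
  adjoin-shortcuts =
    ps , tabulate shortcut , roots-agree dcK dcM , same-verts , λ a b → mk⇔ (split a b) join
    where
    New : Subset n × Subset n → Set
    New (a , b) = Arc K a b × ¬ Arc M a b

    new? : ∀ p → Dec (New p)
    new? (a , b) = T? (E K a b) ×-dec ¬? (T? (E M a b))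

    ps : List (Subset n × Subset n)
    ps = filter new? (subsetPairs n)

    shortcut : ∀ {p} → p ∈ₗ ps → Shortcut M p
    shortcut p∈ =
      let (ab , ¬ab) = proj₂ (∈-filter⁻ new? {xs = subsetPairs n} p∈) ; (a∈ , b∈) = ends ab
      in a∈ , b∈ , arc⇒lt ab , ¬ab

    split : ∀ a b → Arc K a b → Arc M a b ⊎ (a , b) ∈ₗ ps
    split a b ab with T? (E M a b)
    ... | yes ab′ = inj₁ ab′
    ... | no ¬ab = inj₂ (∈-filter⁺ new? (∈-subsetPairs a b) (ab , ¬ab))

    join : ∀ {a b} → Arc M a b ⊎ (a , b) ∈ₗ ps → Arc K a b
    join (inj₁ ab) = irredundant⇒arcs⊆ ab
    join (inj₂ ab∈) = proj₁ (proj₂ (∈-filter⁻ new? {xs = subsetPairs n} ab∈))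

lt-agreement⇒path-agreement : {N N' : Net n}
  → (∀ u w → Lt N' u w → Lt N u w)
  → (∀ u w → InV N' u → InV N' w → Lt N u w → Lt N' u w)
  → ∀ {u w} → InV N' u → InV N' w → Path N u w ⇔ Path N' u w
lt-agreement⇒path-agreement lt'⇒lt lt⇒lt' {u} {w} u∈ w∈ with u ≟ w
... | yes refl = mk⇔ (λ _ → ε) (λ _ → ε)
... | no u≢w = mk⇔ (λ u*w → proj₁ (lt⇒lt' u w u∈ w∈ (u*w , u≢w)))
                  (λ u*w → proj₁ (lt'⇒lt u w (u*w , u≢w)))

theorem7p5 : ∀ {n} (N N' : Net n) → IsDCNet N → IsDCNet N'
    → (∀ u → InV N' u → InV N u)
    → (∀ u v → Lt N' u v → Lt N u v)
    → (∀ u v → InV N' u → InV N' v → Lt N u v → Lt N' u v)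
    → Σ (Net n) λ N'' → CPS N N'' × NoRedundantArcs N''
      × Σ (List (Subset n × Subset n)) λ ps
        → All (λ p → InV N'' (proj₁ p) × InV N'' (proj₂ p)
                 × Lt N'' (proj₁ p) (proj₂ p)
                 × ¬ Arc N'' (proj₁ p) (proj₂ p)) ps
        × AdjoinArcs N'' ps N'
theorem7p5 N N' dcN dcN' N'⊆N lt'⇒lt lt⇒lt' =
  let (M , N*M , N'⇔M) = delete-vertices-outside dcN dcN' N'⊆N
      (N'' , N*N'' , M⇔N'' , irredundant) = delete-redundant-arcs dcN N*M
      N'⇔N'' : ∀ u → InV N' u ⇔ InV N'' u
      N'⇔N'' u = ⇔-trans (N'⇔M u) (M⇔N'' u)
      same-paths : ∀ {u w} → InV N'' u → InV N'' w → Path N'' u w ⇔ Path N' u w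
      same-paths u∈ w∈ = ⇔-trans (Restricts.path⇔ (cps⇒restricts dcN N*N'') u∈ w∈)
        (lt-agreement⇒path-agreement {N = N} {N' = N'} lt'⇒lt lt⇒lt'
           (from (N'⇔N'' _) u∈) (from (N'⇔N'' _) w∈))
      (ps , shortcuts , adjoined) =
        adjoin-shortcuts (cps⇒isDC dcN N*N'') dcN' irredundant N'⇔N'' same-paths
  in N'' , N*N'' , irredundant , ps , shortcuts , adjoined
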